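{- Let $(\mathcal K,r_n,\xi)$ be a Cayley extender with $\Gamma(\mathcal K_{r_n})=\Gamma(\mathcal K)$, and let $p:\mathcal K_{r_n}^\xi\to\mathcal K_{r_n}$ be the projection $(\Phi,\gamma)\mapsto\Phi$. Then every automorphism of $\mathcal K_{r_n}^\xi$ projects to $\mathcal K_{r_n}$: for every $\tilde\tau\in\Gamma(\mathcal K_{r_n}^\xi)$ there is $\tau\in\Gamma(\mathcal K_{r_n})$ with $\tilde\tau p=p\tau$.
   Context: An $n$-premaniplex is a graph (semi-edges and parallel edges allowed) whose vertices, called flags, carry a proper edge colouring with colours $0,\dots,n-1$, each flag $\Phi$ having exactly one incident dart of each colour $i$, with other end $r_i\Phi$; one requires $r_ir_jr_ir_j=1$ for $|i-j|>1$. An $n$-maniplex is a connected $n$-premaniplex in which $r_i$ and $r_ir_j$ ($i\ne j$) have no fixed points. Facets are components after deleting colour-$(n-1)$ edges. Homomorphisms and automorphisms are colour-preserving graph maps, written on the right (so $\tilde\tau p$ means first $\tilde\tau$ then $p$); $\Gamma(\cdot)$ is the automorphism group. A Cayley extender is a triple $(\mathcal K,r_n,\xi)$: $\mathcal K$ an $n$-maniplex; $r_n$ a permutation of its flags with $r_n^2=1$ commuting with $r_0,\dots,r_{n-2}$; $\xi$ a function from facets of $\mathcal K$ to a group $G$ with $\xi(r_n(F))=\xi(F)^{ -1}$; it is assumed $\{\xi(F)\}$ generates $G$ and $\xi(F)\ne1$ whenever $r_n|_F=\mathrm{id}$ or $r_n\Phi=r_i\Phi$ for some $\Phi\in F$,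 $i<n$. The pre-extension $\mathcal K_{r_n}$ is the $(n+1)$-premaniplex with the flags and $i$-adjacencies ($i<n$) of $\mathcal K$ and $n$-adjacency $\Phi\mapsto r_n\Phi$; $\Gamma(\mathcal K_{r_n})$ consists of the automorphisms of $\mathcal K$ commuting with $r_n$. The derived maniplex $\mathcal K_{r_n}^\xi$ has flags $(\Phi,\gamma)$, $\gamma\in G$, with $(\Phi,\gamma)$ $i$-adjacent to $(r_i\Phi,\gamma)$ for $i<n$ and $n$-adjacent to $(r_n\Phi,\xi(F)\gamma)$, $F$ the facet of $\Phi$. -}

module Defs where

open import Data.Nat using (ℕ; zero; suc; _+_; _<_; ∣_-_∣)
open import Data.Fin using (Fin; zero; suc; toℕ)
open import Data.Product using (Σ; Σ-syntax; _×_; _,_; proj₁)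
open import Data.Sum using (_⊎_)
open import Relation.Binary.PropositionalEquality using (_≡_; _≢_)
open import Algebra.Structures using (IsGroup)
open import Function.Definitions using (Bijective)

-- Edge-coloured graphs with one dart of each colour at each flag,
-- presented (as usual) by the maps r_i : Φ ↦ other end of the i-dart.
-- Semi-edges = fixed points of r_i, parallel edges = r_i Φ ≡ r_j Φ.

record Coloured (n : ℕ) : Set₁ where
  field
    Flag : Set
    r    : Fin n → Flag → Flag

open Coloured public

data Reach {n} (X : Coloured n) (allowed : Fin n → Set) (Φ : Flag X) : Flag X → Set where
  here : Reach X allowed Φ Φ
  step : ∀ {Ψ} (i : Fin n) → allowed i → Reach X allowed Φ Ψ → Reach X allowed Φ (r X i Ψ)

record IsPremaniplex {n} (X : Coloured n) : Set where
  field
    r-invol : ∀ i Φ → r X i (r X i Φ) ≡ Φ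
    r-comm  : ∀ i j → 1 < ∣ toℕ i - toℕ j ∣ → ∀ Φ →
              r X i (r X j (r X i (r X j Φ))) ≡ Φ

AnyColour : ∀ {n} → Fin n → Set
AnyColour _ = Data.Unit.⊤
  where import Data.Unit

record IsManiplex {n} (X : Coloured n) : Set where
  field
    premaniplex : IsPremaniplex X
    connected   : ∀ Φ Ψ → Reach X AnyColour Φ Ψ
    r-free      : ∀ i Φ → r X i Φ ≢ Φ
    rr-free     : ∀ i j → i ≢ j → ∀ Φ → r X i (r X j Φ) ≢ Φ

FacetColour : ∀ {n} → Fin n → Set
FacetColour {n} i = suc (toℕ i) < n

SameFacet : ∀ {n} (X : Coloured n) → Flag X → Flag X → Set
SameFacet X Φ Ψ = Reach X FacetColour Φ Ψ

IsAutomorphism : ∀ {n} (X : Coloured n) → (Flag X → Flag X) → Set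
IsAutomorphism X f = Bijective _≡_ _≡_ f × (∀ i Φ → f (r X i Φ) ≡ r X i (f Φ))

record GroupOn : Set₁ where
  field
    Carrier : Set
    _∙_     : Carrier → Carrier → Carrier
    ε       : Carrier
    _⁻¹     : Carrier → Carrier
    isGroup : IsGroup _≡_ _∙_ ε _⁻¹

data Generated (G : GroupOn) (S : GroupOn.Carrier G → Set) : GroupOn.Carrier G → Set where
  gen : ∀ {x} → S x → Generated G S x
  one : Generated G S (GroupOn.ε G)
  mul : ∀ {x y} → Generated G S x → Generated G S y → Generated G S (GroupOn._∙_ G x y)
  inv : ∀ {x} → Generated G S x → Generated G S (GroupOn._⁻¹ G x)

-- colour n appended after colours 0..n-1
snoc : ∀ {n} {A : Set} → (Fin n → A) → A → Fin (suc n) → A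
snoc {zero}  f a zero    = a
snoc {suc n} f a zero    = f zero
snoc {suc n} f a (suc i) = snoc (λ j → f (suc j)) a i

-- Cayley extenders.  ξ, a function on facets, is represented as a function
-- on flags that is constant on facets.

record CayleyExtender (n : ℕ) : Set₁ where
  field
    K          : Coloured n
    K-maniplex : IsManiplex K
    rn         : Flag K → Flag K
    rn-invol   : ∀ Φ → rn (rn Φ) ≡ Φ
    rn-comm    : ∀ i → FacetColour i → ∀ Φ → rn (r K i Φ) ≡ r K i (rn Φ)
    G          : GroupOn
  open GroupOn G
  field
    ξ          : Flag K → Carrier
    ξ-facet    : ∀ Φ Ψ → SameFacet K Φ Ψ → ξ Φ ≡ ξ Ψ
    ξ-rn       : ∀ Φ → ξ (rn Φ) ≡ ξ Φ ⁻¹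
    ξ-gen      : ∀ g → Generated G (λ x → Σ[ Φ ∈ Flag K ] ξ Φ ≡ x) g
    ξ-nontriv  : ∀ Φ →
                 ((∀ Ψ → SameFacet K Φ Ψ → rn Ψ ≡ Ψ)
                  ⊎ (Σ[ Ψ ∈ Flag K ] SameFacet K Φ Ψ × Σ[ i ∈ Fin n ] rn Ψ ≡ r K i Ψ))
                 → ξ Φ ≢ ε

  preExt : Coloured (suc n)
  preExt = record { Flag = Flag K ; r = snoc (r K) rn }

  derived : Coloured (suc n)
  derived = record
    { Flag = Flag K × Carrier
    ; r    = snoc (λ i x → (r K i (proj₁ x) , Data.Product.proj₂ x))
                  (λ x → (rn (proj₁ x) , ξ (proj₁ x) ∙ Data.Product.proj₂ x))
    }
    where import Data.Product

  p : Flag derived → Flag preExt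
  p = proj₁

{-# OPTIONS --safe #-}
-- Write τ̃ (Φ , γ) = (σ_γ Φ , π_γ Φ). Since τ̃ commutes with the colours i < n, which do not
-- change γ, each slice σ_γ is an automorphism of K and π_γ is constant (K is connected).
-- By hypothesis σ_γ then also commutes with r_n, and comparing the n-edge at (Φ , γ) gives
-- σ_{ξ(Φ) γ} (r_n Φ) = σ_γ (r_n Φ); two automorphisms of a connected K agreeing at one
-- flag coincide, so σ_{ξ(Φ) γ} = σ_γ. As the ξ(Φ) generate G, σ_γ = σ_ε for every γ,
-- and τ = σ_ε is the required projection.
module Submission where

open import Defs
open import Data.Nat using (ℕ; zero; suc)
open import Data.Fin using (Fin; zero; suc; fromℕ; inject₁)
open import Data.Product using (Σ-syntax; _×_; _,_; proj₁; proj₂)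
open import Relation.Binary.PropositionalEquality
open import Algebra.Structures using (IsGroup)

snoc-fromℕ : ∀ {n} {A : Set} (f : Fin n → A) (a : A) → snoc f a (fromℕ n) ≡ a
snoc-fromℕ {zero}  f a = refl
snoc-fromℕ {suc n} f a = snoc-fromℕ (λ j → f (suc j)) a

snoc-inject₁ : ∀ {n} {A : Set} (f : Fin n → A) (a : A) (i : Fin n) →
               snoc f a (inject₁ i) ≡ f i
snoc-inject₁ {suc n} f a zero    = refl
snoc-inject₁ {suc n} f a (suc i) = snoc-inject₁ (λ j → f (suc j)) a i

Commutes : ∀ {m} (X : Coloured m) → (Flag X → Flag X) → Set
Commutes X f = ∀ i Φ → f (r X i Φ) ≡ r X i (f Φ)

module Connected {m} (X : Coloured m) (connected : ∀ Φ Ψ → Reach X AnyColour Φ Ψ) where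

  edge-invariant⇒constant : ∀ {A : Set} (g : Flag X → A) →
                            (∀ i Φ → g (r X i Φ) ≡ g Φ) → ∀ Φ Ψ → g Φ ≡ g Ψ
  edge-invariant⇒constant g invariant Φ Ψ = go (connected Φ Ψ)
    where
    go : ∀ {Ψ} → Reach X AnyColour Φ Ψ → g Φ ≡ g Ψ
    go here          = refl
    go (step i _ Φ⇝) = trans (go Φ⇝) (sym (invariant i _))

  commuting-maps-agree : (f g : Flag X → Flag X) → Commutes X f → Commutes X g →
                         ∀ Φ → f Φ ≡ g Φ → ∀ Ψ → f Ψ ≡ g Ψ
  commuting-maps-agree f g f-comm g-comm Φ fΦ≡gΦ Ψ = go (connected Φ Ψ)
    where
    go : ∀ {Ψ} → Reach X AnyColour Φ Ψ → f Ψ ≡ g Ψ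
    go here          = fΦ≡gΦ
    go (step i _ Φ⇝) = trans (f-comm i _) (trans (cong (r X i) (go Φ⇝)) (sym (g-comm i _)))

  commuting-map-surjective : (f : Flag X → Flag X) → Commutes X f →
                             ∀ Ψ → Σ[ Φ ∈ Flag X ] f Φ ≡ Ψ
  commuting-map-surjective f f-comm Ψ = go (connected (f Ψ) Ψ)
    where
    go : ∀ {Ψ′} → Reach X AnyColour (f Ψ) Ψ′ → Σ[ Φ ∈ Flag X ] f Φ ≡ Ψ′
    go here          = Ψ , refl
    go (step i _ Φ⇝) with go Φ⇝
    ... | Φ , fΦ≡Ψ′ = r X i Φ , trans (f-comm i Φ) (cong (r X i) fΦ≡Ψ′)

  injective-commuting⇒automorphism : (f : Flag X → Flag X) →
                                     (∀ {Φ Ψ} → f Φ ≡ f Ψ → Φ ≡ Ψ) → Commutes X f →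
                                     IsAutomorphism X f
  injective-commuting⇒automorphism f f-inj f-comm =
    (f-inj , λ Ψ → let (Φ , fΦ≡Ψ) = commuting-map-surjective f f-comm Ψ
                   in Φ , λ z≡Φ → trans (cong f z≡Φ) fΦ≡Ψ)
    , f-comm

module _ (G : GroupOn) where
  open GroupOn G
  open IsGroup isGroup using (assoc; identityˡ; identityʳ; inverseʳ)

  generated-left-invariant : ∀ {A : Set} {S : Carrier → Set} (f : Carrier → A) →
                             (∀ {s} → S s → ∀ γ → f (s ∙ γ) ≡ f γ) →
                             ∀ {x} → Generated G S x → ∀ γ → f (x ∙ γ) ≡ f γ
  generated-left-invariant f invariant (gen s) γ = invariant s γ
  generated-left-invariant f invariant one γ = cong f (identityˡ γ)
  generated-left-invariant f invariant (mul {x} {y} gx gy) γ = begin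
    f ((x ∙ y) ∙ γ)  ≡⟨ cong f (assoc x y γ) ⟩
    f (x ∙ (y ∙ γ))  ≡⟨ generated-left-invariant f invariant gx (y ∙ γ) ⟩
    f (y ∙ γ)        ≡⟨ generated-left-invariant f invariant gy γ ⟩
    f γ              ∎
    where open ≡-Reasoning
  generated-left-invariant f invariant (inv {x} gx) γ = begin
    f ((x ⁻¹) ∙ γ)        ≡⟨ generated-left-invariant f invariant gx ((x ⁻¹) ∙ γ) ⟨
    f (x ∙ ((x ⁻¹) ∙ γ))  ≡⟨ cong f (assoc x (x ⁻¹) γ) ⟨
    f ((x ∙ (x ⁻¹)) ∙ γ)  ≡⟨ cong (λ y → f (y ∙ γ)) (inverseʳ x) ⟩
    f (ε ∙ γ)             ≡⟨ cong f (identityˡ γ) ⟩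
    f γ                   ∎
    where open ≡-Reasoning

  generated-invariant⇒constant : ∀ {A : Set} {S : Carrier → Set} (f : Carrier → A) →
                                 (∀ x → Generated G S x) →
                                 (∀ {s} → S s → ∀ γ → f (s ∙ γ) ≡ f γ) →
                                 ∀ γ → f γ ≡ f ε
  generated-invariant⇒constant f generates invariant γ =
    trans (cong f (sym (identityʳ γ))) (generated-left-invariant f invariant (generates γ) ε)

module Projection {n : ℕ} (E : CayleyExtender n) where
  open CayleyExtender E
  open GroupOn G
  open Connected K (IsManiplex.connected K-maniplex)

  private
    rD₀ : Fin n → Flag derived → Flag derived
    rD₀ i (Φ , γ) = r K i Φ , γ

    rDₙ : Flag derived → Flag derived
    rDₙ (Φ , γ) = rn Φ , ξ Φ ∙ γ

  derived-r-inject₁ : ∀ i x → r derived (inject₁ i) x ≡ (r K i (proj₁ x) , proj₂ x)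
  derived-r-inject₁ i x = cong (λ h → h x) (snoc-inject₁ rD₀ rDₙ i)

  derived-r-fromℕ : ∀ x → r derived (fromℕ n) x ≡ (rn (proj₁ x) , ξ (proj₁ x) ∙ proj₂ x)
  derived-r-fromℕ x = cong (λ h → h x) (snoc-fromℕ rD₀ rDₙ)

  preExt-r-fromℕ : ∀ Φ → r preExt (fromℕ n) Φ ≡ rn Φ
  preExt-r-fromℕ Φ = cong (λ h → h Φ) (snoc-fromℕ (r K) rn)

  module Slices (τ̃ : Flag derived → Flag derived) (τ̃-aut : IsAutomorphism derived τ̃) where

    σ : Carrier → Flag K → Flag K
    σ γ Φ = proj₁ (τ̃ (Φ , γ))

    π : Carrier → Flag K → Carrier
    π γ Φ = proj₂ (τ̃ (Φ , γ))

    τ̃-r : ∀ γ i Φ → τ̃ (r K i Φ , γ) ≡ (r K i (σ γ Φ) , π γ Φ)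
    τ̃-r γ i Φ = begin
      τ̃ (r K i Φ , γ)                   ≡⟨ cong τ̃ (derived-r-inject₁ i (Φ , γ)) ⟨
      τ̃ (r derived (inject₁ i) (Φ , γ))  ≡⟨ proj₂ τ̃-aut (inject₁ i) (Φ , γ) ⟩
      r derived (inject₁ i) (τ̃ (Φ , γ))  ≡⟨ derived-r-inject₁ i (τ̃ (Φ , γ)) ⟩
      (r K i (σ γ Φ) , π γ Φ)            ∎
      where open ≡-Reasoning

    τ̃-rn : ∀ γ Φ → σ (ξ Φ ∙ γ) (rn Φ) ≡ rn (σ γ Φ)
    τ̃-rn γ Φ = cong proj₁ (begin
      τ̃ (rn Φ , ξ Φ ∙ γ)                 ≡⟨ cong τ̃ (derived-r-fromℕ (Φ , γ)) ⟨
      τ̃ (r derived (fromℕ n) (Φ , γ))    ≡⟨ proj₂ τ̃-aut (fromℕ n) (Φ , γ) ⟩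
      r derived (fromℕ n) (τ̃ (Φ , γ))    ≡⟨ derived-r-fromℕ (τ̃ (Φ , γ)) ⟩
      (rn (σ γ Φ) , ξ (σ γ Φ) ∙ π γ Φ)   ∎)
      where open ≡-Reasoning

    σ-commutes : ∀ γ → Commutes K (σ γ)
    σ-commutes γ i Φ = cong proj₁ (τ̃-r γ i Φ)

    π-constant : ∀ γ Φ Ψ → π γ Φ ≡ π γ Ψ
    π-constant γ = edge-invariant⇒constant (π γ) (λ i Φ → cong proj₂ (τ̃-r γ i Φ))

    σ-injective : ∀ γ {Φ Ψ} → σ γ Φ ≡ σ γ Ψ → Φ ≡ Ψ
    σ-injective γ {Φ} {Ψ} σΦ≡σΨ =
      cong proj₁ (proj₁ (proj₁ τ̃-aut) (cong₂ _,_ σΦ≡σΨ (π-constant γ Φ Ψ)))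

    σ-automorphism : ∀ γ → IsAutomorphism K (σ γ)
    σ-automorphism γ = injective-commuting⇒automorphism (σ γ) (σ-injective γ) (σ-commutes γ)

    module _ (lift : ∀ f → IsAutomorphism K f → IsAutomorphism preExt f) where

      σ-automorphism-preExt : ∀ γ → IsAutomorphism preExt (σ γ)
      σ-automorphism-preExt γ = lift (σ γ) (σ-automorphism γ)

      σ-rn : ∀ γ Φ → σ γ (rn Φ) ≡ rn (σ γ Φ)
      σ-rn γ Φ = begin
        σ γ (rn Φ)                     ≡⟨ cong (σ γ) (preExt-r-fromℕ Φ) ⟨
        σ γ (r preExt (fromℕ n) Φ)     ≡⟨ proj₂ (σ-automorphism-preExt γ) (fromℕ n) Φ ⟩
        r preExt (fromℕ n) (σ γ Φ)     ≡⟨ preExt-r-fromℕ (σ γ Φ) ⟩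
        rn (σ γ Φ)                     ∎
        where open ≡-Reasoning

      σ-ξ-invariant : ∀ Φ γ Ψ → σ (ξ Φ ∙ γ) Ψ ≡ σ γ Ψ
      σ-ξ-invariant Φ γ =
        commuting-maps-agree (σ (ξ Φ ∙ γ)) (σ γ) (σ-commutes _) (σ-commutes γ)
          (rn Φ) (trans (τ̃-rn γ Φ) (sym (σ-rn γ Φ)))

      σ-independent : ∀ γ Ψ → σ γ Ψ ≡ σ ε Ψ
      σ-independent γ Ψ =
        generated-invariant⇒constant G (λ γ → σ γ Ψ) ξ-gen
          (λ { (Φ , refl) γ → σ-ξ-invariant Φ γ Ψ }) γ

proposition5p3 : ∀ {n : ℕ} (E : CayleyExtender n) →
    let open CayleyExtender E in
    (∀ f → IsAutomorphism K f → IsAutomorphism preExt f) →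
    ∀ τ̃ → IsAutomorphism derived τ̃ →
    Σ[ τ ∈ (Flag preExt → Flag preExt) ]
      (IsAutomorphism preExt τ × (∀ x → p (τ̃ x) ≡ τ (p x)))
proposition5p3 E lift τ̃ τ̃-aut =
  σ ε , σ-automorphism-preExt lift ε , λ (Φ , γ) → σ-independent lift γ Φ
  where
  open GroupOn (CayleyExtender.G E) using (ε)
  open Projection.Slices E τ̃ τ̃-aut
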